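{- Let $k\ge 2$ and let ${\sf lcm}(k)$ denote the least common multiple of $1,2,\ldots,k$. Then the full transformation semigroup $T_k$ satisfies the identity $$x^{k-2+{\sf lcm}(k)}yx^{k-1}= x^{k-2}yx^{k-1+{\sf lcm}(k)},$$ i.e., for all $x,y\in T_k$ the two products are equal.
   Context: $T_k$ is the semigroup of all maps of $\{1,\ldots,k\}$ to itself under composition. -}

module Defs where

open import Data.Nat using (ℕ; zero; suc)
open import Data.Nat.LCM using (lcm)
open import Data.Fin using (Fin)

lcmUpTo : ℕ → ℕ
lcmUpTo zero    = 1
lcmUpTo (suc k) = lcm (suc k) (lcmUpTo k)

T : ℕ → Set
T k = Fin k → Fin k

-- Semigroup product in T_k, maps written on the right:
-- (f · g) means "first apply f, then g", i.e. i ↦ g (f i).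
_·_ : ∀ {k} → T k → T k → T k
(f · g) i = g (f i)
infixl 7 _·_

-- Powers x^n for n ≥ 1 (x ^ 0 is the identity map, only used as a
-- building block; the identity below only uses exponents ≥ 1 or the
-- case k - 2 = 0 where x^0 y means just y).
_^_ : ∀ {k} → T k → ℕ → T k
(x ^ zero)  i = i
(x ^ suc n) = x · (x ^ n)

-- Write L = lcm(1,…,k). For every w the orbit w, x w, x² w, … of x has a tail of
-- length < k and then a cycle of length ≤ k, so x^(m+L) w = x^m w for all m ≥ k−1;
-- this already gives the identity whenever x^(k−2+L) i = x^(k−2) i. Otherwise the
-- orbit of i has no repetition among its first k points, so it exhausts {1,…,k} and
-- its k-th point is fixed by x; then x^(k−1) is a constant map and both sides agree.
module Submission where

open import Defs
open import Data.Nat using (ℕ; zero; suc; _+_; _∸_; _*_; _≤_; _<_; _≥_; s≤s; z≤n)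
open import Data.Nat.Properties
open import Algebra.Properties.CommutativeSemigroup +-commutativeSemigroup
  using (xy∙z≈xz∙y; x∙yz≈xz∙y)
open import Data.Nat.Divisibility using (_∣_; divides; ∣-trans)
open import Data.Nat.LCM using (m∣lcm[m,n]; n∣lcm[m,n])
open import Data.Fin using (Fin; toℕ) renaming (zero to fzero; suc to fsuc)
open import Data.Fin.Properties using (pigeonhole; toℕ<n) renaming (_≟_ to _≟ᶠ_)
open import Data.Vec.Functional using (_∷_)
open import Data.Product using (_×_; _,_; ∃-syntax; ∃₂)
open import Data.Sum using (_⊎_; inj₁; inj₂)
open import Data.Empty using (⊥-elim)
open import Relation.Nullary using (yes; no)
open import Relation.Binary.PropositionalEquality

∣lcmUpTo : ∀ {k d} → 0 < d → d ≤ k → d ∣ lcmUpTo k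
∣lcmUpTo {zero}  0<d d≤0 = ⊥-elim (<⇒≱ 0<d d≤0)
∣lcmUpTo {suc k} 0<d d≤1+k with m≤n⇒m<n∨m≡n d≤1+k
... | inj₂ refl      = m∣lcm[m,n] (suc k) (lcmUpTo k)
... | inj₁ (s≤s d≤k) = ∣-trans (∣lcmUpTo 0<d d≤k) (n∣lcm[m,n] (suc k) (lcmUpTo k))

module _ {K : ℕ} (x : T K) where

  ^-+ : ∀ m n w → (x ^ (m + n)) w ≡ (x ^ n) ((x ^ m) w)
  ^-+ zero    n w = refl
  ^-+ (suc m) n w = ^-+ m n (x w)

  ^-cong : ∀ {m n} w → m ≡ n → (x ^ m) w ≡ (x ^ n) w
  ^-cong w refl = refl

  ^-shift : ∀ {m n w} → (x ^ m) w ≡ (x ^ n) w → ∀ e → (x ^ (m + e)) w ≡ (x ^ (n + e)) w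
  ^-shift {m} {n} {w} eq e = begin
    (x ^ (m + e)) w     ≡⟨ ^-+ m e w ⟩
    (x ^ e) ((x ^ m) w) ≡⟨ cong (x ^ e) eq ⟩
    (x ^ e) ((x ^ n) w) ≡⟨ ^-+ n e w ⟨
    (x ^ (n + e)) w     ∎
    where open ≡-Reasoning

  ^-period : ∀ {p d m w} → (x ^ p) w ≡ (x ^ (p + d)) w → p ≤ m → (x ^ (m + d)) w ≡ (x ^ m) w
  ^-period {p} {d} {w = w} eq p≤m with e , refl ← m≤n⇒∃[o]m+o≡n p≤m =
    trans (^-cong w (xy∙z≈xz∙y p e d)) (^-shift {p + d} {p} {w} (sym eq) e)

  ^-period-* : ∀ {p d m w} → (x ^ p) w ≡ (x ^ (p + d)) w → p ≤ m →
               ∀ c → (x ^ (m + c * d)) w ≡ (x ^ m) w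
  ^-period-* {m = m} {w} eq p≤m zero = ^-cong w (+-identityʳ m)
  ^-period-* {p} {d} {m} {w} eq p≤m (suc c) = begin
    (x ^ (m + (d + c * d))) w ≡⟨ ^-cong w (x∙yz≈xz∙y m d (c * d)) ⟩
    (x ^ (m + c * d + d)) w   ≡⟨ ^-period eq (≤-trans p≤m (m≤m+n m (c * d))) ⟩
    (x ^ (m + c * d)) w       ≡⟨ ^-period-* eq p≤m c ⟩
    (x ^ m) w                 ∎
    where open ≡-Reasoning

  orbit-or-collision : ∀ w z → (∃[ m ] m < K × z ≡ (x ^ m) w)
                             ⊎ (∃₂ λ p q → p < q × q < K × (x ^ p) w ≡ (x ^ q) w)
  orbit-or-collision w z with pigeonhole ≤-refl (z ∷ λ m → (x ^ toℕ m) w)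
  ... | fzero  , fsuc b , _         , eq = inj₁ (toℕ b , toℕ<n b , eq)
  ... | fsuc a , fsuc b , s≤s a<b , eq = inj₂ (toℕ a , toℕ b , a<b , toℕ<n b , eq)

  collision : ∀ w → ∃₂ λ p q → p < q × q ≤ K × (x ^ p) w ≡ (x ^ q) w
  collision w with orbit-or-collision w ((x ^ K) w)
  ... | inj₁ (m , m<K , eq)          = m , K , m<K , ≤-refl , sym eq
  ... | inj₂ (p , q , p<q , q<K , eq) = p , q , p<q , <⇒≤ q<K , eq

module _ {K : ℕ} (x : T K) {L : ℕ} (∣L : ∀ {d} → 0 < d → d ≤ K → d ∣ L) where

  collision⇒periodic : ∀ {p q m w} → p < q → q ≤ K → (x ^ p) w ≡ (x ^ q) w → p ≤ m →
                       (x ^ (m + L)) w ≡ (x ^ m) w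
  collision⇒periodic {p} {q} {m} {w} p<q q≤K eq p≤m
    with divides c L≡c*d ← ∣L (m<n⇒0<n∸m p<q) (≤-trans (m∸n≤m q p) q≤K) =
    trans (^-cong x w (cong (m +_) L≡c*d))
          (^-period-* x (trans eq (^-cong x w (sym (m+[n∸m]≡n (<⇒≤ p<q))))) p≤m c)

  ^-periodic : ∀ {m} → K ≤ suc m → ∀ w → (x ^ (m + L)) w ≡ (x ^ m) w
  ^-periodic K≤1+m w with p , q , p<q , q≤K , eq ← collision x w =
    collision⇒periodic p<q q≤K eq (≤-pred (≤-trans p<q (≤-trans q≤K K≤1+m)))

module _ {n : ℕ} (x : T (suc (suc n))) {L : ℕ} (∣L : ∀ {d} → 0 < d → d ≤ suc (suc n) → d ∣ L)
         {i : Fin (suc (suc n))} (aperiodic : (x ^ (n + L)) i ≢ (x ^ n) i) where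

  late-collision : ∀ {p q} → p < q → q ≤ suc (suc n) → (x ^ p) i ≡ (x ^ q) i → n < p
  late-collision p<q q≤K eq = ≰⇒> λ p≤n → aperiodic (collision⇒periodic x ∣L p<q q≤K eq p≤n)

  orbit-exhaustive : ∀ z → ∃[ m ] m < suc (suc n) × z ≡ (x ^ m) i
  orbit-exhaustive z with orbit-or-collision x i z
  ... | inj₁ inOrbit = inOrbit
  ... | inj₂ (p , q , p<q , s≤s q≤1+n , eq) =
    ⊥-elim (<⇒≱ (late-collision p<q (m≤n⇒m≤1+n q≤1+n) eq) (≤-pred (≤-trans p<q q≤1+n)))

  orbit-fixed : (x ^ suc n) i ≡ (x ^ (suc n + 1)) i
  orbit-fixed with m , m<K , eq ← orbit-exhaustive ((x ^ suc (suc n)) i) = begin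
    (x ^ suc n) i        ≡⟨ ^-cong x i m≡1+n ⟨
    (x ^ m) i            ≡⟨ eq ⟨
    (x ^ suc (suc n)) i  ≡⟨ ^-cong x i (+-comm 1 (suc n)) ⟩
    (x ^ (suc n + 1)) i  ∎
    where
    open ≡-Reasoning
    m≡1+n : m ≡ suc n
    m≡1+n = ≤-antisym (≤-pred m<K) (late-collision m<K ≤-refl (sym eq))

  ^-constant : ∀ z → (x ^ suc n) z ≡ (x ^ suc n) i
  ^-constant z with m , _ , refl ← orbit-exhaustive z = begin
    (x ^ suc n) ((x ^ m) i) ≡⟨ ^-+ x m (suc n) i ⟨
    (x ^ (m + suc n)) i     ≡⟨ ^-cong x i (+-comm m (suc n)) ⟩
    (x ^ (suc n + m)) i     ≡⟨ ^-cong x i (cong (suc n +_) (*-identityʳ m)) ⟨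
    (x ^ (suc n + m * 1)) i ≡⟨ ^-period-* x {suc n} {1} {suc n} {i} orbit-fixed ≤-refl m ⟩
    (x ^ suc n) i           ∎
    where open ≡-Reasoning

proposition3 : (k : ℕ) → k ≥ 2 → (x y : T k) → (i : Fin k) →
    (x ^ (k ∸ 2 + lcmUpTo k) · y · x ^ (k ∸ 1)) i
    ≡ (x ^ (k ∸ 2) · y · x ^ (k ∸ 1 + lcmUpTo k)) i
proposition3 (suc (suc n)) (s≤s (s≤s z≤n)) x y i with (x ^ (n + lcmUpTo (suc (suc n)))) i ≟ᶠ (x ^ n) i
... | yes periodic = trans (cong (λ w → (x ^ suc n) (y w)) periodic)
                           (sym (^-periodic x ∣lcmUpTo ≤-refl _))
... | no aperiodic = trans (constant _)
                           (sym (trans (^-periodic x ∣lcmUpTo ≤-refl _) (constant _)))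
  where
  constant = ^-constant x ∣lcmUpTo aperiodic
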